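{- Let $\zeta_1,\zeta_2,\zeta_3\in wAC(P)$. Then in $wAC(P)/\equiv$: (i) $\overline{\big[[\zeta_1]\otimes[\zeta_2]\big]}\otimes\overline{[\zeta_3]}=\overline{[\zeta_1]}\otimes\overline{\big[[\zeta_2]\otimes[\zeta_3]\big]}$; (ii) $\overline{\big[[\zeta_1]'\otimes[\zeta_2]'\big]'}\otimes\overline{[\zeta_3]'}=\overline{[\zeta_1]'}\otimes\overline{\big[[\zeta_2]'\otimes[\zeta_3]'\big]'}$.
   Context: $(K,\oplus,\otimes,\hat0,\hat1)$ is a commutative, additively idempotent semiring; $P$ is a finite nonempty set of ports with $0,1\notin P$ and weights $k_p\in K$. $wAI(P)$ is the weighted Algebra of Interactions: terms $z::=0\mid1\mid p\mid z\oplus z\mid z\otimes z\mid(z)$, with semantics $\|z\|(\gamma)\in K$ for $\gamma\in\Gamma(P)=2^{2^P}$: $\|0\|(\gamma)=\hat0$; $\|1\|(\gamma)=\hat1$ iff $\emptyset\in\gamma$ (else $\hat0$); $\|p\|(\gamma)=k_p$ if some $a\in\gamma$ contains $p$ (else $\hat0$); $\|z_1\oplus z_2\|(\gamma)=\bigoplus_{a\in\gamma}(\|z_1\|(\{a\})\oplus\|z_2\|(\{a\}))$; $\|z_1\otimes z_2\|(\gamma)=\bigoplus_{a\in\gamma}\bigoplus_{a_1\cup a_2=a}(\|z_1\|(\{a_1\})\otimes\|z_2\|(\{a_2\}))$ (inner sum over pairs of possibly empty subsets of $P$); $\|(z)\|=\|z\|$. On $wAI(P)$, $z_1\equiv z_2$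 iff $\|z_1\|=\|z_2\|$ on all of $\Gamma(P)$; the quotient $wAI(P)/\equiv$ is a commutative idempotent semiring under $\oplus,\otimes$ with zero $\overline0$ and one $\overline1$, and computations with $wAI(P)$ terms are done in it. The weighted Algebra of Connectors $wAC(P)$ has syntax: synchrons $\sigma::=[0]\mid[1]\mid[p]\mid[\zeta]$, triggers $\tau::=[0]'\mid[1]'\mid[p]'\mid[\zeta]'$, and $\zeta::=\sigma\mid\tau\mid\zeta\oplus\zeta\mid\zeta\otimes\zeta$, where weighted fusion $\otimes$ is applied to typed connectors; $[\zeta]^{\alpha}$ denotes $[\zeta]$ if $\alpha=0$ and $[\zeta]'$ if $\alpha=1$. The semantics $|\cdot|:wAC(P)\to wAI(P)$ is: $|[p]|=|[p]'|=p$ for $p\in P\cup\{0,1\}$; $|[\zeta]|=|[\zeta]'|=|\zeta|$; $|\zeta_1\oplus\zeta_2|=|\zeta_1|\oplus|\zeta_2|$; $|[\zeta_1]\otimes\cdots\otimes[\zeta_n]|=|\zeta_1|\otimes\cdots\otimes|\zeta_n|$; and if at least one $\alpha_i=1$, $|[\zeta_1]^{\alpha_1}\otimes\cdots\otimes[\zeta_n]^{\alpha_n}|=\bigoplus_{i:\alpha_i=1}\big(|\zeta_i|\otimes\bigotimes_{k\ne i,\alpha_k=1}(1\oplus|\zeta_k|)\otimes\bigotimes_{j:\alpha_j=0}(1\oplus|\zeta_j|)\big)$ (for $n=2$ with two triggers: $(|\zeta_1|\otimes(1\oplus|\zeta_2|))\oplus(|\zeta_2|\otimes(1\oplus|\zeta_1|))$).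 Two connectors are equivalent, $\zeta_1\equiv\zeta_2$, iff $|\zeta_1|\equiv|\zeta_2|$ in $wAI(P)$. $\overline{\zeta}$ is the class of $\zeta$ in $wAC(P)/\equiv$, with $\overline{\zeta_1}\oplus\overline{\zeta_2}=\overline{\zeta_1\oplus\zeta_2}$ and $\overline{[\zeta_1]^\alpha}\otimes\overline{[\zeta_2]^\beta}=\overline{[\zeta_1]^\alpha\otimes[\zeta_2]^\beta}$ (well defined). -}

module Defs where

open import Level using (Level)
open import Data.Nat using (ℕ; zero; suc)
open import Data.Bool using (Bool; true; false; _∧_; if_then_else_)
open import Data.Fin using (Fin)
open import Data.Fin.Subset using (Subset; ⊥; _∪_)
open import Data.Vec using (Vec; []; _∷_; lookup)
open import Data.List using (List; []; _∷_; _++_; map; foldr; filterᵇ; concatMap)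
open import Data.Bool.ListAction using (any)
open import Data.Product using (_×_; _,_; proj₁; proj₂)
open import Algebra.Bundles using (CommutativeSemiring)

-- Ports: P = Fin n (finite; nonemptiness is a hypothesis 1 ≤ n in the
-- statement).  The constants 0 and 1 are separate constructors, so
-- 0,1 ∉ P automatically.
-- Interactions a ⊆ P are Subset n; γ ∈ Γ(P) = 2^(2^P) is a predicate
-- Subset n → Bool (a finite set of interactions, given by membership).

Γ : ℕ → Set
Γ n = Subset n → Bool

allSubsets : (n : ℕ) → List (Subset n)
allSubsets zero = [] ∷ []
allSubsets (suc n) = map (true ∷_) (allSubsets n) ++ map (false ∷_) (allSubsets n)

_==ˢ_ : ∀ {n} → Subset n → Subset n → Bool
[] ==ˢ [] = true
(true ∷ a) ==ˢ (true ∷ b) = a ==ˢ b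
(false ∷ a) ==ˢ (false ∷ b) = a ==ˢ b
(true ∷ a) ==ˢ (false ∷ b) = false
(false ∷ a) ==ˢ (true ∷ b) = false

sing : ∀ {n} → Subset n → Γ n
sing a b = a ==ˢ b

elems : ∀ {n} → Γ n → List (Subset n)
elems {n} γ = filterᵇ γ (allSubsets n)

splits : ∀ {n} → Subset n → List (Subset n × Subset n)
splits {n} a =
  filterᵇ (λ q → (proj₁ q ∪ proj₂ q) ==ˢ a)
    (concatMap (λ a₁ → map (λ a₂ → (a₁ , a₂)) (allSubsets n)) (allSubsets n))

infixl 6 _⊕_
infixl 7 _⊗_

data wAI (n : ℕ) : Set where
  𝟘 : wAI n
  𝟙 : wAI n
  port : Fin n → wAI n
  _⊕_ : wAI n → wAI n → wAI n
  _⊗_ : wAI n → wAI n → wAI n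

-- Semantics of wAI(P) over a commutative semiring K with port weights k
-- (additive idempotence of K is a hypothesis of the theorem).

module Sem {c ℓ : Level} (K : CommutativeSemiring c ℓ) {n : ℕ} (k : Fin n → CommutativeSemiring.Carrier K) where
  open CommutativeSemiring K renaming (_+_ to _⊞_; _*_ to _⊠_)

  ⨁ : ∀ {A : Set} → List A → (A → Carrier) → Carrier
  ⨁ xs f = foldr (λ x r → f x ⊞ r) 0# xs

  ‖_‖ : wAI n → Γ n → Carrier
  ‖ 𝟘 ‖ γ = 0#
  ‖ 𝟙 ‖ γ = if γ ⊥ then 1# else 0#
  ‖ port p ‖ γ = if any (λ a → γ a ∧ lookup a p) (allSubsets n) then k p else 0#
  ‖ z₁ ⊕ z₂ ‖ γ = ⨁ (elems γ) (λ a → ‖ z₁ ‖ (sing a) ⊞ ‖ z₂ ‖ (sing a))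
  ‖ z₁ ⊗ z₂ ‖ γ = ⨁ (elems γ) (λ a →
                     ⨁ (splits a) (λ q → ‖ z₁ ‖ (sing (proj₁ q)) ⊠ ‖ z₂ ‖ (sing (proj₂ q))))

  _≈I_ : wAI n → wAI n → Set ℓ
  z₁ ≈I z₂ = ∀ (γ : Γ n) → ‖ z₁ ‖ γ ≈ ‖ z₂ ‖ γ

-- Typed connectors are [ζ]^α (α = false: synchron,
-- α = true: trigger), with ζ an atom p ∈ P ∪ {0,1} or a connector.
-- Weighted fusion is an n-ary operation (n ≥ 2) on typed connectors.

data Atom (n : ℕ) : Set where
  a0 : Atom n
  a1 : Atom n
  ap : Fin n → Atom n

mutual
  data wAC (n : ℕ) : Set where
    typed : Typed n → wAC n
    _⊕ᶜ_  : wAC n → wAC n → wAC n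
    fuse  : Typed n → Typed n → List (Typed n) → wAC n

  data Typed (n : ℕ) : Set where
    atom : Atom n → Bool → Typed n
    box  : wAC n → Bool → Typed n

infixl 7 _⊗ᶜ_
_⊗ᶜ_ : ∀ {n} → Typed n → Typed n → wAC n
t₁ ⊗ᶜ t₂ = fuse t₁ t₂ []

atomSem : ∀ {n} → Atom n → wAI n
atomSem a0 = 𝟘
atomSem a1 = 𝟙
atomSem (ap p) = port p

prod⁺ : ∀ {n} → wAI n → List (wAI n) → wAI n
prod⁺ x [] = x
prod⁺ x (y ∷ ys) = x ⊗ prod⁺ y ys

sum⁺ : ∀ {n} → wAI n → List (wAI n) → wAI n
sum⁺ x [] = x
sum⁺ x (y ∷ ys) = x ⊕ sum⁺ y ys

picks : ∀ {A : Set} → List A → List (A × List A)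
picks [] = []
picks (x ∷ xs) = (x , xs) ∷ map (λ q → proj₁ q , x ∷ proj₂ q) (picks xs)

-- semantics of a fusion [ζ₁]^α₁ ⊗ ⋯ ⊗ [ζₘ]^αₘ, given the list of (αᵢ , |ζᵢ|)
fusionSem : ∀ {n} → Bool × wAI n → List (Bool × wAI n) → wAI n
fusionSem {n} t ts with filterᵇ (λ q → proj₁ (proj₁ q)) (picks (t ∷ ts))
... | [] = prod⁺ (proj₂ t) (map proj₂ ts)                       -- all synchrons
... | i ∷ is = sum⁺ (term i) (map term is)                      -- some trigger
  where
  term : (Bool × wAI n) × List (Bool × wAI n) → wAI n
  term (x , others) = prod⁺ (proj₂ x) (map (λ y → 𝟙 ⊕ proj₂ y) others)

mutual
  ∣_∣ : ∀ {n} → wAC n → wAI n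
  ∣ typed t ∣ = typedSem t
  ∣ ζ₁ ⊕ᶜ ζ₂ ∣ = ∣ ζ₁ ∣ ⊕ ∣ ζ₂ ∣
  ∣ fuse t₁ t₂ ts ∣ = fusionSem (typeSem t₁ , typedSem t₁)
                        ((typeSem t₂ , typedSem t₂) ∷ semList ts)

  typedSem : ∀ {n} → Typed n → wAI n
  typedSem (atom a α) = atomSem a
  typedSem (box ζ α) = ∣ ζ ∣

  semList : ∀ {n} → List (Typed n) → List (Bool × wAI n)
  semList [] = []
  semList (t ∷ ts) = (typeSem t , typedSem t) ∷ semList ts

  typeSem : ∀ {n} → Typed n → Bool
  typeSem (atom a α) = α
  typeSem (box ζ α) = α

-- ζ₁ ≡ ζ₂ in wAC(P): |ζ₁| ≡ |ζ₂| in wAI(P); equality in wAC(P)/≡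
module _ {c ℓ : Level} (K : CommutativeSemiring c ℓ) {n : ℕ} (k : Fin n → CommutativeSemiring.Carrier K) where
  open Sem K k
  _≈C_ : wAC n → wAC n → Set ℓ
  ζ₁ ≈C ζ₂ = ∣ ζ₁ ∣ ≈I ∣ ζ₂ ∣

-- On a single interaction a, the semantics of wAI(P) is a homomorphism into
-- the convolution semiring of functions 2^P → K, whose product is
-- (f ⋆ g) a = ⊕_{a₁ ∪ a₂ = a} f a₁ ⊗ g a₂; it is commutative and associative
-- because (2^P, ∪) is a commutative monoid. The semantics of ⊕ and ⊗ on an
-- arbitrary γ is a sum over a ∈ γ of this singleton semantics. The connectors
-- in (i) compute to (z₁ ⊗ z₂) ⊗ z₃ and z₁ ⊗ (z₂ ⊗ z₃), so (i) is associativity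
-- of ⋆; those in (ii) compute to the two bracketings of the trigger fusion
-- z ⊛ w = z(1 ⊕ w) ⊕ w(1 ⊕ z), so (ii) is associativity of
-- x ∗ y = x(1 + y) + y(1 + x), a polynomial identity valid in every commutative
-- semiring.
{-# OPTIONS --safe #-}
module Submission where

open import Defs
open import Level using (Level)
open import Data.Nat using (ℕ; _≤_; zero; suc)
open import Data.Bool using (Bool; true; false; if_then_else_)
open import Data.Fin using (Fin)
open import Data.Fin.Subset using (Subset; _∪_) renaming (⊥ to ∅)
open import Data.Fin.Subset.Properties using (∪-assoc; ∪-comm; ∪-identityˡ)
open import Data.Vec using ([]; _∷_)
open import Data.List using (List; []; _∷_; _++_; map; foldr; filterᵇ; concatMap)
open import Data.Product using (_×_; _,_; proj₁; proj₂)
open import Algebra.Bundles using (CommutativeSemiring)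
open import Algebra.Definitions using (Idempotent)
open import Algebra.Structures.Biased using (isCommutativeSemiringˡ; isCommutativeMonoidˡ)
import Algebra.Construct.Pointwise as Pointwise
import Algebra.Properties.CommutativeSemigroup as CommSemigroupProperties
import Algebra.Solver.Ring.NaturalCoefficients.Default as NaturalSolver
open import Relation.Binary.PropositionalEquality as ≡ using (_≡_)

==ˢ-sym : ∀ {n} (a b : Subset n) → (a ==ˢ b) ≡ (b ==ˢ a)
==ˢ-sym [] [] = ≡.refl
==ˢ-sym (true ∷ a) (true ∷ b) = ==ˢ-sym a b
==ˢ-sym (false ∷ a) (false ∷ b) = ==ˢ-sym a b
==ˢ-sym (true ∷ a) (false ∷ b) = ≡.refl
==ˢ-sym (false ∷ a) (true ∷ b) = ≡.refl

module TriggerFusion {c ℓ : Level} (R : CommutativeSemiring c ℓ) where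
  open CommutativeSemiring R
  open NaturalSolver R using (solve; _:=_; _:+_; _:*_; con)

  _∗_ : Carrier → Carrier → Carrier
  x ∗ y = x * (1# + y) + y * (1# + x)

  ∗-assoc : ∀ x y z → (x ∗ y) ∗ z ≈ x ∗ (y ∗ z)
  ∗-assoc = solve 3 (λ x y z →
    let _⊛_ = λ u v → u :* (con 1 :+ v) :+ v :* (con 1 :+ u)
    in (x ⊛ y) ⊛ z := x ⊛ (y ⊛ z)) refl

module FiniteSums {c ℓ : Level} (K : CommutativeSemiring c ℓ) where
  open CommutativeSemiring K
  open CommSemigroupProperties +-commutativeSemigroup using (interchange)
  open import Relation.Binary.Reasoning.Setoid setoid

  ⨁ : ∀ {A : Set} → List A → (A → Carrier) → Carrier
  ⨁ xs f = foldr (λ x r → f x + r) 0# xs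

  ⨁-cong : ∀ {A : Set} (xs : List A) {f g : A → Carrier} → (∀ x → f x ≈ g x) → ⨁ xs f ≈ ⨁ xs g
  ⨁-cong [] f≈g = refl
  ⨁-cong (x ∷ xs) f≈g = +-cong (f≈g x) (⨁-cong xs f≈g)

  ⨁-zero : ∀ {A : Set} (xs : List A) → ⨁ xs (λ _ → 0#) ≈ 0#
  ⨁-zero [] = refl
  ⨁-zero (x ∷ xs) = trans (+-identityˡ _) (⨁-zero xs)

  ⨁-++ : ∀ {A : Set} (xs ys : List A) (f : A → Carrier) → ⨁ (xs ++ ys) f ≈ ⨁ xs f + ⨁ ys f
  ⨁-++ [] ys f = sym (+-identityˡ _)
  ⨁-++ (x ∷ xs) ys f = trans (+-congˡ (⨁-++ xs ys f)) (sym (+-assoc _ _ _))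

  ⨁-map : ∀ {A B : Set} (g : A → B) (xs : List A) (f : B → Carrier) → ⨁ (map g xs) f ≈ ⨁ xs (λ x → f (g x))
  ⨁-map g [] f = refl
  ⨁-map g (x ∷ xs) f = +-congˡ (⨁-map g xs f)

  ⨁-concatMap : ∀ {A B : Set} (g : A → List B) (xs : List A) (f : B → Carrier)
    → ⨁ (concatMap g xs) f ≈ ⨁ xs (λ x → ⨁ (g x) f)
  ⨁-concatMap g [] f = refl
  ⨁-concatMap g (x ∷ xs) f = trans (⨁-++ (g x) (concatMap g xs) f) (+-congˡ (⨁-concatMap g xs f))

  indicator : Bool → Carrier
  indicator b = if b then 1# else 0#

  ⨁-filterᵇ : ∀ {A : Set} (p : A → Bool) (xs : List A) (f : A → Carrier)
    → ⨁ (filterᵇ p xs) f ≈ ⨁ xs (λ x → indicator (p x) * f x)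
  ⨁-filterᵇ p [] f = refl
  ⨁-filterᵇ p (x ∷ xs) f with p x
  ... | true = +-cong (sym (*-identityˡ _)) (⨁-filterᵇ p xs f)
  ... | false = trans (⨁-filterᵇ p xs f) (sym (trans (+-congʳ (zeroˡ _)) (+-identityˡ _)))

  ⨁-+ : ∀ {A : Set} (xs : List A) (f g : A → Carrier) → ⨁ xs (λ x → f x + g x) ≈ ⨁ xs f + ⨁ xs g
  ⨁-+ [] f g = sym (+-identityˡ _)
  ⨁-+ (x ∷ xs) f g = trans (+-congˡ (⨁-+ xs f g)) (interchange _ _ _ _)

  *-distribˡ-⨁ : ∀ {A : Set} (xs : List A) (x : Carrier) (f : A → Carrier) → x * ⨁ xs f ≈ ⨁ xs (λ a → x * f a)
  *-distribˡ-⨁ [] x f = zeroʳ x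
  *-distribˡ-⨁ (a ∷ xs) x f = trans (distribˡ _ _ _) (+-congˡ (*-distribˡ-⨁ xs x f))

  *-distribʳ-⨁ : ∀ {A : Set} (xs : List A) (x : Carrier) (f : A → Carrier) → ⨁ xs f * x ≈ ⨁ xs (λ a → f a * x)
  *-distribʳ-⨁ xs x f = trans (*-comm _ _) (trans (*-distribˡ-⨁ xs x f) (⨁-cong xs (λ a → *-comm _ _)))

  ⨁-comm : ∀ {A B : Set} (xs : List A) (ys : List B) (f : A → B → Carrier)
    → ⨁ xs (λ x → ⨁ ys (f x)) ≈ ⨁ ys (λ y → ⨁ xs (λ x → f x y))
  ⨁-comm [] ys f = sym (⨁-zero ys)
  ⨁-comm (x ∷ xs) ys f = trans (+-congˡ (⨁-comm xs ys f)) (sym (⨁-+ ys (f x) _))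

  ⨁-rotate₃ : ∀ {A B C : Set} (xs : List A) (ys : List B) (zs : List C) (f : A → B → C → Carrier)
    → ⨁ xs (λ x → ⨁ ys (λ y → ⨁ zs (f x y))) ≈ ⨁ ys (λ y → ⨁ zs (λ z → ⨁ xs (λ x → f x y z)))
  ⨁-rotate₃ xs ys zs f = trans (⨁-comm xs ys _) (⨁-cong ys (λ y → ⨁-comm xs zs _))

  *-distrib-⨁* : ∀ {A : Set} (xs : List A) x y (f : A → Carrier) → x * (⨁ xs f * y) ≈ ⨁ xs (λ a → x * (f a * y))
  *-distrib-⨁* xs x y f = trans (*-congˡ (*-distribʳ-⨁ xs y f)) (*-distribˡ-⨁ xs x _)

  *-distrib-*⨁ : ∀ {A : Set} (xs : List A) x y (f : A → Carrier) → x * (y * ⨁ xs f) ≈ ⨁ xs (λ a → x * (y * f a))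
  *-distrib-*⨁ xs x y f = trans (*-congˡ (*-distribˡ-⨁ xs y f)) (*-distribˡ-⨁ xs x _)

  δ : ∀ {n} → Subset n → Subset n → Carrier
  δ a b = indicator (a ==ˢ b)

  ⨁-δˡ : ∀ n (t : Subset n) (g : Subset n → Carrier) → ⨁ (allSubsets n) (λ b → δ t b * g b) ≈ g t
  ⨁-δˡ zero [] g = trans (+-identityʳ _) (*-identityˡ _)
  ⨁-δˡ (suc n) (x ∷ t) g = begin
    ⨁ (map (true ∷_) S ++ map (false ∷_) S) F             ≈⟨ ⨁-++ (map (true ∷_) S) _ F ⟩
    ⨁ (map (true ∷_) S) F + ⨁ (map (false ∷_) S) F      ≈⟨ +-cong (⨁-map _ S F) (⨁-map _ S F) ⟩
    ⨁ S (λ b → F (true ∷ b)) + ⨁ S (λ b → F (false ∷ b)) ≈⟨ sift x ⟩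
    g (x ∷ t)                                             ∎
    where
    S : List (Subset n)
    S = allSubsets n
    F : Subset (suc n) → Carrier
    F b = δ (x ∷ t) b * g b
    off : (h : Subset n → Carrier) → ⨁ S (λ b → 0# * h b) ≈ 0#
    off h = trans (⨁-cong S (λ b → zeroˡ _)) (⨁-zero S)
    sift : ∀ y → ⨁ S (λ b → δ (y ∷ t) (true ∷ b) * g (true ∷ b))
                 + ⨁ S (λ b → δ (y ∷ t) (false ∷ b) * g (false ∷ b)) ≈ g (y ∷ t)
    sift true = trans (+-cong (⨁-δˡ n t _) (off _)) (+-identityʳ _)
    sift false = trans (+-cong (off _) (⨁-δˡ n t _)) (+-identityˡ _)

  ⨁-δʳ : ∀ n (t : Subset n) (g : Subset n → Carrier) → ⨁ (allSubsets n) (λ b → δ b t * g b) ≈ g t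
  ⨁-δʳ n t g = trans (⨁-cong (allSubsets n) (λ b → *-congʳ (reflexive (≡.cong indicator (==ˢ-sym b t)))))
                     (⨁-δˡ n t g)

module Convolution {c ℓ : Level} (K : CommutativeSemiring c ℓ) (n : ℕ) where
  open CommutativeSemiring K
  open CommSemigroupProperties *-commutativeSemigroup using (x∙yz≈y∙xz)
  open FiniteSums K
  open import Relation.Binary.Reasoning.Setoid setoid

  S : List (Subset n)
  S = allSubsets n

  Fn : Set c
  Fn = Subset n → Carrier

  _≈ᶠ_ : Fn → Fn → Set ℓ
  f ≈ᶠ g = ∀ a → f a ≈ g a

  _+ᶠ_ : Fn → Fn → Fn
  (f +ᶠ g) a = f a + g a

  0ᶠ : Fn
  0ᶠ a = 0#

  1ᶠ : Fn
  1ᶠ a = δ a ∅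

  _⋆_ : Fn → Fn → Fn
  (f ⋆ g) a = ⨁ (splits a) (λ q → f (proj₁ q) * g (proj₂ q))

  ⋆-expand : ∀ f g a → (f ⋆ g) a ≈ ⨁ S (λ b → ⨁ S (λ c → δ (b ∪ c) a * (f b * g c)))
  ⋆-expand f g a = begin
    (f ⋆ g) a                                                      ≈⟨ ⨁-filterᵇ _ pairs _ ⟩
    ⨁ pairs (λ q → δ (proj₁ q ∪ proj₂ q) a * (f (proj₁ q) * g (proj₂ q))) ≈⟨ ⨁-concatMap _ S _ ⟩
    ⨁ S (λ b → ⨁ (map (b ,_) S) (λ q → δ (proj₁ q ∪ proj₂ q) a * (f (proj₁ q) * g (proj₂ q))))
                                                                   ≈⟨ ⨁-cong S (λ b → ⨁-map _ S _) ⟩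
    ⨁ S (λ b → ⨁ S (λ c → δ (b ∪ c) a * (f b * g c)))             ∎
    where
    pairs : List (Subset n × Subset n)
    pairs = concatMap (λ a₁ → map (a₁ ,_) S) S

  ⋆-cong : ∀ {f f′ g g′} → f ≈ᶠ f′ → g ≈ᶠ g′ → (f ⋆ g) ≈ᶠ (f′ ⋆ g′)
  ⋆-cong f≈f′ g≈g′ a = ⨁-cong (splits a) (λ q → *-cong (f≈f′ _) (g≈g′ _))

  ⋆-comm : ∀ f g → (f ⋆ g) ≈ᶠ (g ⋆ f)
  ⋆-comm f g a = begin
    (f ⋆ g) a
      ≈⟨ ⋆-expand f g a ⟩
    ⨁ S (λ b → ⨁ S (λ c → δ (b ∪ c) a * (f b * g c)))
      ≈⟨ ⨁-comm S S _ ⟩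
    ⨁ S (λ c → ⨁ S (λ b → δ (b ∪ c) a * (f b * g c)))
      ≈⟨ ⨁-cong S (λ c → ⨁-cong S (λ b → *-cong (reflexive (≡.cong (λ x → δ x a) (∪-comm b c))) (*-comm _ _))) ⟩
    ⨁ S (λ c → ⨁ S (λ b → δ (c ∪ b) a * (g c * f b)))
      ≈⟨ ⋆-expand g f a ⟨
    (g ⋆ f) a
      ∎

  ⋆-zeroˡ : ∀ f → (0ᶠ ⋆ f) ≈ᶠ 0ᶠ
  ⋆-zeroˡ f a = trans (⨁-cong (splits a) (λ q → zeroˡ _)) (⨁-zero (splits a))

  ⋆-distribʳ : ∀ f g h → ((g +ᶠ h) ⋆ f) ≈ᶠ ((g ⋆ f) +ᶠ (h ⋆ f))
  ⋆-distribʳ f g h a = trans (⨁-cong (splits a) (λ q → distribʳ _ _ _)) (⨁-+ (splits a) _ _)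

  ⋆-identityˡ : ∀ f → (1ᶠ ⋆ f) ≈ᶠ f
  ⋆-identityˡ f a = begin
    (1ᶠ ⋆ f) a
      ≈⟨ ⋆-expand 1ᶠ f a ⟩
    ⨁ S (λ b → ⨁ S (λ c → δ (b ∪ c) a * (δ b ∅ * f c)))
      ≈⟨ ⨁-cong S (λ b → trans (⨁-cong S (λ c → x∙yz≈y∙xz _ _ _)) (sym (*-distribˡ-⨁ S _ _))) ⟩
    ⨁ S (λ b → δ b ∅ * ⨁ S (λ c → δ (b ∪ c) a * f c))
      ≈⟨ ⨁-δʳ n ∅ _ ⟩
    ⨁ S (λ c → δ (∅ ∪ c) a * f c)
      ≈⟨ ⨁-cong S (λ c → reflexive (≡.cong (λ x → δ x a * f c) (∪-identityˡ c))) ⟩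
    ⨁ S (λ c → δ c a * f c)
      ≈⟨ ⨁-δʳ n a f ⟩
    f a
      ∎

  ⋆-expandˡ : ∀ f g h a → ((f ⋆ g) ⋆ h) a ≈ ⨁ S (λ d → ⨁ S (λ e → ⨁ S (λ c → δ ((d ∪ e) ∪ c) a * ((f d * g e) * h c))))
  ⋆-expandˡ f g h a = begin
    ((f ⋆ g) ⋆ h) a
      ≈⟨ ⋆-expand _ h a ⟩
    ⨁ S (λ b → ⨁ S (λ c → δ (b ∪ c) a * ((f ⋆ g) b * h c)))
      ≈⟨ ⨁-cong S (λ b → ⨁-cong S (λ c → *-congˡ (*-congʳ (⋆-expand f g b)))) ⟩
    ⨁ S (λ b → ⨁ S (λ c → δ (b ∪ c) a * (⨁ S (λ d → ⨁ S (λ e → δ (d ∪ e) b * (f d * g e))) * h c)))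
      ≈⟨ ⨁-cong S (λ b → ⨁-cong S (λ c → trans (*-distrib-⨁* S _ _ _) (⨁-cong S (λ d →
           trans (*-distrib-⨁* S _ _ _) (⨁-cong S (λ e → trans (*-congˡ (*-assoc _ _ _)) (x∙yz≈y∙xz _ _ _))))))) ⟩
    ⨁ S (λ b → ⨁ S (λ c → ⨁ S (λ d → ⨁ S (λ e → δ (d ∪ e) b * (δ (b ∪ c) a * ((f d * g e) * h c))))))
      ≈⟨ trans (⨁-cong S (λ b → ⨁-rotate₃ S S S _)) (⨁-rotate₃ S S S _) ⟩
    ⨁ S (λ d → ⨁ S (λ e → ⨁ S (λ b → ⨁ S (λ c → δ (d ∪ e) b * (δ (b ∪ c) a * ((f d * g e) * h c))))))
      ≈⟨ ⨁-cong S (λ d → ⨁-cong S (λ e → trans (⨁-comm S S _) (⨁-cong S (λ c → ⨁-δˡ n (d ∪ e) _)))) ⟩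
    ⨁ S (λ d → ⨁ S (λ e → ⨁ S (λ c → δ ((d ∪ e) ∪ c) a * ((f d * g e) * h c))))
      ∎

  ⋆-expandʳ : ∀ f g h a → (f ⋆ (g ⋆ h)) a ≈ ⨁ S (λ b → ⨁ S (λ d → ⨁ S (λ e → δ (b ∪ (d ∪ e)) a * (f b * (g d * h e)))))
  ⋆-expandʳ f g h a = begin
    (f ⋆ (g ⋆ h)) a
      ≈⟨ ⋆-expand f _ a ⟩
    ⨁ S (λ b → ⨁ S (λ c → δ (b ∪ c) a * (f b * (g ⋆ h) c)))
      ≈⟨ ⨁-cong S (λ b → ⨁-cong S (λ c → *-congˡ (*-congˡ (⋆-expand g h c)))) ⟩
    ⨁ S (λ b → ⨁ S (λ c → δ (b ∪ c) a * (f b * ⨁ S (λ d → ⨁ S (λ e → δ (d ∪ e) c * (g d * h e))))))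
      ≈⟨ ⨁-cong S (λ b → ⨁-cong S (λ c → trans (*-distrib-*⨁ S _ _ _) (⨁-cong S (λ d →
           trans (*-distrib-*⨁ S _ _ _) (⨁-cong S (λ e → trans (*-congˡ (x∙yz≈y∙xz _ _ _)) (x∙yz≈y∙xz _ _ _))))))) ⟩
    ⨁ S (λ b → ⨁ S (λ c → ⨁ S (λ d → ⨁ S (λ e → δ (d ∪ e) c * (δ (b ∪ c) a * (f b * (g d * h e)))))))
      ≈⟨ ⨁-cong S (λ b → ⨁-rotate₃ S S S _) ⟩
    ⨁ S (λ b → ⨁ S (λ d → ⨁ S (λ e → ⨁ S (λ c → δ (d ∪ e) c * (δ (b ∪ c) a * (f b * (g d * h e)))))))
      ≈⟨ ⨁-cong S (λ b → ⨁-cong S (λ d → ⨁-cong S (λ e → ⨁-δˡ n (d ∪ e) _))) ⟩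
    ⨁ S (λ b → ⨁ S (λ d → ⨁ S (λ e → δ (b ∪ (d ∪ e)) a * (f b * (g d * h e)))))
      ∎

  ⋆-assoc : ∀ f g h → ((f ⋆ g) ⋆ h) ≈ᶠ (f ⋆ (g ⋆ h))
  ⋆-assoc f g h a = trans (⋆-expandˡ f g h a) (trans
    (⨁-cong S (λ d → ⨁-cong S (λ e → ⨁-cong S (λ c →
      *-cong (reflexive (≡.cong (λ x → δ x a) (∪-assoc d e c))) (*-assoc _ _ _)))))
    (sym (⋆-expandʳ f g h a)))

  convolutionSemiring : CommutativeSemiring c ℓ
  convolutionSemiring = record
    { Carrier = Fn ; _≈_ = _≈ᶠ_ ; _+_ = _+ᶠ_ ; _*_ = _⋆_ ; 0# = 0ᶠ ; 1# = 1ᶠ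
    ; isCommutativeSemiring = isCommutativeSemiringˡ (record
      { +-isCommutativeMonoid = Pointwise.isCommutativeMonoid (Subset n) +-isCommutativeMonoid
      ; *-isCommutativeMonoid = isCommutativeMonoidˡ (record
        { isSemigroup = record
          { isMagma = record
            { isEquivalence = Pointwise.isEquivalence (Subset n) isEquivalence
            ; ∙-cong = ⋆-cong }
          ; assoc = ⋆-assoc }
        ; identityˡ = ⋆-identityˡ
        ; comm = ⋆-comm })
      ; distribʳ = ⋆-distribʳ
      ; zeroˡ = ⋆-zeroˡ })
    }

module SingletonSemantics {c ℓ : Level} (K : CommutativeSemiring c ℓ) {n : ℕ}
                          (k : Fin n → CommutativeSemiring.Carrier K) where
  open CommutativeSemiring K
  open FiniteSums K
  open Convolution K n
  open TriggerFusion convolutionSemiring using (_∗_; ∗-assoc)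
  open Sem K k using (‖_‖; _≈I_)

  ⟦_⟧ : wAI n → Fn
  ⟦ 𝟘 ⟧ = 0ᶠ
  ⟦ 𝟙 ⟧ = 1ᶠ
  ⟦ port p ⟧ a = ‖ port p ‖ (sing a)
  ⟦ z ⊕ w ⟧ = ⟦ z ⟧ +ᶠ ⟦ w ⟧
  ⟦ z ⊗ w ⟧ = ⟦ z ⟧ ⋆ ⟦ w ⟧

  ⨁-sing : ∀ a (g : Fn) → ⨁ (elems (sing a)) g ≈ g a
  ⨁-sing a g = trans (⨁-filterᵇ (sing a) S g) (⨁-δˡ n a g)

  ‖‖-sing : ∀ z a → ‖ z ‖ (sing a) ≈ ⟦ z ⟧ a
  ‖‖-sing 𝟘 a = refl
  ‖‖-sing 𝟙 a = refl
  ‖‖-sing (port p) a = refl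
  ‖‖-sing (z ⊕ w) a = trans (⨁-sing a _) (+-cong (‖‖-sing z a) (‖‖-sing w a))
  ‖‖-sing (z ⊗ w) a = trans (⨁-sing a _) (⋆-cong (‖‖-sing z) (‖‖-sing w) a)

  ‖⊕‖ : ∀ z w γ → ‖ z ⊕ w ‖ γ ≈ ⨁ (elems γ) ⟦ z ⊕ w ⟧
  ‖⊕‖ z w γ = ⨁-cong (elems γ) (λ a → +-cong (‖‖-sing z a) (‖‖-sing w a))

  ‖⊗‖ : ∀ z w γ → ‖ z ⊗ w ‖ γ ≈ ⨁ (elems γ) ⟦ z ⊗ w ⟧
  ‖⊗‖ z w γ = ⨁-cong (elems γ) (⋆-cong (‖‖-sing z) (‖‖-sing w))

  ⊗-assocᴵ : (z₁ z₂ z₃ : wAI n) → ((z₁ ⊗ z₂) ⊗ z₃) ≈I (z₁ ⊗ (z₂ ⊗ z₃))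
  ⊗-assocᴵ z₁ z₂ z₃ γ = begin
    ‖ (z₁ ⊗ z₂) ⊗ z₃ ‖ γ               ≈⟨ ‖⊗‖ (z₁ ⊗ z₂) z₃ γ ⟩
    ⨁ (elems γ) ⟦ (z₁ ⊗ z₂) ⊗ z₃ ⟧     ≈⟨ ⨁-cong (elems γ) (⋆-assoc ⟦ z₁ ⟧ ⟦ z₂ ⟧ ⟦ z₃ ⟧) ⟩
    ⨁ (elems γ) ⟦ z₁ ⊗ (z₂ ⊗ z₃) ⟧     ≈⟨ ‖⊗‖ z₁ (z₂ ⊗ z₃) γ ⟨
    ‖ z₁ ⊗ (z₂ ⊗ z₃) ‖ γ               ∎
    where open import Relation.Binary.Reasoning.Setoid setoid

  infixl 7 _⊛_
  _⊛_ : wAI n → wAI n → wAI n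
  z ⊛ w = z ⊗ (𝟙 ⊕ w) ⊕ w ⊗ (𝟙 ⊕ z)

  ⊛-assocᴵ : (z₁ z₂ z₃ : wAI n) → ((z₁ ⊛ z₂) ⊛ z₃) ≈I (z₁ ⊛ (z₂ ⊛ z₃))
  ⊛-assocᴵ z₁ z₂ z₃ γ = begin
    ‖ (z₁ ⊛ z₂) ⊛ z₃ ‖ γ               ≈⟨ ‖⊕‖ ((z₁ ⊛ z₂) ⊗ (𝟙 ⊕ z₃)) (z₃ ⊗ (𝟙 ⊕ (z₁ ⊛ z₂))) γ ⟩
    ⨁ (elems γ) ⟦ (z₁ ⊛ z₂) ⊛ z₃ ⟧     ≈⟨ ⨁-cong (elems γ) (∗-assoc ⟦ z₁ ⟧ ⟦ z₂ ⟧ ⟦ z₃ ⟧) ⟩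
    ⨁ (elems γ) ⟦ z₁ ⊛ (z₂ ⊛ z₃) ⟧     ≈⟨ ‖⊕‖ (z₁ ⊗ (𝟙 ⊕ (z₂ ⊛ z₃))) ((z₂ ⊛ z₃) ⊗ (𝟙 ⊕ z₁)) γ ⟨
    ‖ z₁ ⊛ (z₂ ⊛ z₃) ‖ γ               ∎
    where open import Relation.Binary.Reasoning.Setoid setoid

proposition3 : ∀ {c ℓ : Level} (K : CommutativeSemiring c ℓ)
  → Idempotent (CommutativeSemiring._≈_ K) (CommutativeSemiring._+_ K)
  → (n : ℕ) → 1 ≤ n → (k : Fin n → CommutativeSemiring.Carrier K)
  → (ζ₁ ζ₂ ζ₃ : wAC n)
  → _≈C_ K k (box (box ζ₁ false ⊗ᶜ box ζ₂ false) false ⊗ᶜ box ζ₃ false)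
             (box ζ₁ false ⊗ᶜ box (box ζ₂ false ⊗ᶜ box ζ₃ false) false)
    × _≈C_ K k (box (box ζ₁ true ⊗ᶜ box ζ₂ true) true ⊗ᶜ box ζ₃ true)
               (box ζ₁ true ⊗ᶜ box (box ζ₂ true ⊗ᶜ box ζ₃ true) true)
proposition3 K _ n _ k ζ₁ ζ₂ ζ₃ = ⊗-assocᴵ (∣ ζ₁ ∣) (∣ ζ₂ ∣) (∣ ζ₃ ∣) , ⊛-assocᴵ (∣ ζ₁ ∣) (∣ ζ₂ ∣) (∣ ζ₃ ∣)
  where open SingletonSemantics K k
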